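{- Writing $\beta_2(r) = \beta_2(r,r-1)$, for all integers $r_1, r_2 \ge 3$ we have $\beta_2(r_1+r_2) \le \beta_2(r_1) + \beta_2(r_2) + 6$.
   Context: A $k$-partite graph comes with a fixed partition of its vertex set into $k$ parts (parts may be empty). For $k \ge r \ge 2$ and $1 \le i \le k-r+1$, $\beta_i(k,r)$ is the minimum number of vertices of a $K_r$-free $k$-partite graph such that, for every choice of $k-i$ of its parts, the subgraph induced by those parts contains a $K_{r-1}$. -}

module Defs where

open import Data.Nat using (ℕ; _∸_; _≤_)
open import Data.Fin using (Fin)
open import Data.Fin.Subset using (Subset; _∈_; ∣_∣)
open import Data.Product using (Σ; _×_)
open import Relation.Binary.PropositionalEquality using (_≡_; _≢_)
open import Relation.Nullary using (¬_)

record KPartiteGraph (k n : ℕ) : Set₁ where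
  field
    part    : Fin n → Fin k
    Adj     : Fin n → Fin n → Set
    sym     : ∀ {u v} → Adj u v → Adj v u
    -- no edge inside a part (this also makes the graph loopless)
    partite : ∀ {u v} → Adj u v → part u ≢ part v

open KPartiteGraph public

CliqueIn : ∀ {k n} → KPartiteGraph k n → (s : ℕ) → Subset k → Set
CliqueIn {k} {n} G s S =
  Σ (Fin s → Fin n) λ f →
    (∀ i j → i ≢ j → Adj G (f i) (f j)) × (∀ i → part G (f i) ∈ S)

KFree : ∀ {k n} → KPartiteGraph k n → ℕ → Set
KFree {k} G s = ∀ (S : Subset k) → ¬ CliqueIn G s S

-- An n-vertex witness for β_i(k,r): a K_r-free k-partite graph such that
-- for every choice S of k-i of its parts, the subgraph induced by S
-- contains a K_{r-1}.
Admissible : (i k r n : ℕ) → Set₁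
Admissible i k r n =
  Σ (KPartiteGraph k n) λ G →
    KFree G r × (∀ (S : Subset k) → ∣ S ∣ ≡ k ∸ i → CliqueIn G (r ∸ 1) S)

IsBeta : (i k r b : ℕ) → Set₁
IsBeta i k r b = Admissible i k r b × (∀ n → Admissible i k r n → b ≤ n)

IsBeta₂ : (r b : ℕ) → Set₁
IsBeta₂ r b = IsBeta 2 r (r ∸ 1) b

module Submission where

-- Let G₁, G₂ be optimal witnesses for β₂(r₁), β₂(r₂): Gᵢ is rᵢ-partite, K_{rᵢ-1}-free, and
-- every rᵢ - 2 of its parts span a K_{rᵢ-2}.  Put G₁ on the first r₁ and G₂ on the last r₂
-- parts of an (r₁ + r₂)-partite graph, add a triangle-free six-vertex gadget H with vertices
-- a₀ a₁ a₂ in the first three parts of G₁ and b₀ b₁ b₂ in the first three parts of G₂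
-- (edges: the 4-cycle a₀ a₁ b₁ b₀ and the edge a₂ b₂), and join the three pieces completely,
-- i.e. vertices from different pieces are adjacent iff they lie in different parts.
--
-- * K-freeness: a clique of the join of two graphs splits into a clique of each (pigeonhole),
--   so a K_{r₁+r₂-1} would need a K_{r₁-1} in G₁, a K_{r₂-1} in G₂ or a triangle in H.
-- * Covering: r₁ + r₂ - 2 parts S miss two parts.  Either S contains all parts of G₁ (use the
--   edge a₀a₁), or all parts of G₂ (use b₀b₁), or misses one part on each side (use some aₖbₖ
--   lying in S).  In each case the remaining parts of S contain r₁ - 2 parts of G₁ and r₂ - 2
--   of G₂ avoiding the edge, so the cliques of G₁ and G₂ together with the edge form a
--   K_{r₁+r₂-2} in S.

open import Defs
open import Data.Nat using (ℕ; _+_; _≤_)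

open import Data.Bool using (Bool; true; false; T; _∨_)
open import Data.Bool.Properties using (T?; ∨-comm)
open import Data.Empty using (⊥-elim)
open import Data.Fin as Fin using (Fin; zero; suc; toℕ; _↑ˡ_; _↑ʳ_; splitAt; lift)
open import Data.Fin.Properties
  using (all?; ↑ˡ-injective; ↑ʳ-injective; splitAt-↑ˡ; splitAt-↑ʳ; splitAt-join; join-splitAt;
         lift-injective)
  renaming (suc-injective to Fin-suc-injective)
open import Data.Fin.Subset
  using (Subset; _∈_; _∉_; _⊆_; ∣_∣; _─_; _-_; _∪_; ⁅_⁆; ⊤; inside; outside)
  renaming (⊥ to ∅)
open import Data.Fin.Subset.Properties
  using (_∈?_; ∈⊤; ⊥⊆; ∣⊥∣≡0; ∣p∣≤n; ∣p∣≡n⇒p≡⊤; s⊆s; out⊆; p⊆p∪q; x∈p∪q⁺; x∈p∪q⁻; p⊂q⇒∣p∣<∣q∣;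
         x∈⁅x⁆; x∈⁅y⁆⇒x≡y; x∉⁅y⁆⇒x≢y; ∣⁅x⁆∣≡1; p─q⊆p; x∈p∧x≢y⇒x∈p-y)
open import Data.Nat using (suc; _∸_; z≤n; s≤s; s≤s⁻¹)
open import Data.Nat.Properties
  using (≤-refl; ≤-trans; ≤-reflexive; ≤∧≢⇒<; <-irrefl; +-suc; +-comm; +-monoˡ-≤; +-monoʳ-≤;
         +-cancelˡ-≤; m≤n⇒m≤1+n; _≟_)
open import Data.Nat.Tactic.RingSolver using (solve-∀)
open import Data.Product using (Σ; ∃; _×_; _,_; proj₁; proj₂; map₂; swap)
open import Data.Sum as Sum using (_⊎_; inj₁; inj₂; [_,_]′)
open import Data.Vec as Vec using ([]; _∷_; _++_; here; there)
open import Data.Vec.Properties using (lookup-++ˡ; lookup-++ʳ; []=⇒lookup; lookup⇒[]=)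
open import Function using (_∘_; id)
open import Function.Definitions using (Injective)
open import Relation.Binary.PropositionalEquality
  using (_≡_; _≢_; refl; cong; subst; subst₂; trans) renaming (sym to ≡-sym)
open import Relation.Nullary using (¬_; Dec; yes; no; ¬?)
open import Relation.Nullary.Decidable using (toWitness; _×-dec_)

slack : ∀ {a b c d} → a + b ≡ c + d → a ≤ c → d ≤ b
slack {a} {b} {c} {d} eq a≤c = +-cancelˡ-≤ c d b (subst (_≤ c + b) eq (+-monoˡ-≤ b a≤c))

-- splitAt m is injective, with left inverse join m n.
splitAt-injective : ∀ m {n} {i j : Fin (m + n)} → splitAt m i ≡ splitAt m j → i ≡ j
splitAt-injective m {n} {i} {j} eq =
  trans (≡-sym (join-splitAt m n i)) (trans (cong (Fin.join m n) eq) (join-splitAt m n j))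

↑ˡ≢↑ʳ : ∀ {m n} (i : Fin m) (j : Fin n) → i ↑ˡ n ≢ m ↑ʳ j
↑ˡ≢↑ʳ {m} {n} i j eq
  with trans (≡-sym (splitAt-↑ˡ m i n)) (trans (cong (splitAt m) eq) (splitAt-↑ʳ m n j))
... | ()

glue-injective : ∀ {a b} {X : Set} {f : Fin a → X} {g : Fin b → X} →
  Injective _≡_ _≡_ f → Injective _≡_ _≡_ g → (∀ i j → f i ≢ g j) →
  Injective _≡_ _≡_ ([ f , g ]′ ∘ splitAt a)
glue-injective {a} {f = f} {g} f-inj g-inj apart {x} {y} eq =
  splitAt-injective a (copair (splitAt a x) (splitAt a y) eq)
  where
    copair : ∀ u v → [ f , g ]′ u ≡ [ f , g ]′ v → u ≡ v
    copair (inj₁ i) (inj₁ j) e = cong inj₁ (f-inj e)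
    copair (inj₂ i) (inj₂ j) e = cong inj₂ (g-inj e)
    copair (inj₁ i) (inj₂ j) e = ⊥-elim (apart i j e)
    copair (inj₂ i) (inj₁ j) e = ⊥-elim (apart j i (≡-sym e))

∣++∣ : ∀ {m n} (S₁ : Subset m) (S₂ : Subset n) → ∣ S₁ ++ S₂ ∣ ≡ ∣ S₁ ∣ + ∣ S₂ ∣
∣++∣ [] S₂ = refl
∣++∣ (inside ∷ S₁) S₂ = cong suc (∣++∣ S₁ S₂)
∣++∣ (outside ∷ S₁) S₂ = ∣++∣ S₁ S₂

∈-++⁺ˡ : ∀ {m n} {S₁ : Subset m} (S₂ : Subset n) {x} → x ∈ S₁ → x ↑ˡ n ∈ S₁ ++ S₂
∈-++⁺ˡ {S₁ = S₁} S₂ {x} x∈S₁ = lookup⇒[]= _ _ (trans (lookup-++ˡ S₁ S₂ x) ([]=⇒lookup x∈S₁))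

∈-++⁺ʳ : ∀ {m n} (S₁ : Subset m) {S₂ : Subset n} {x} → x ∈ S₂ → m ↑ʳ x ∈ S₁ ++ S₂
∈-++⁺ʳ S₁ {S₂} {x} x∈S₂ = lookup⇒[]= _ _ (trans (lookup-++ʳ S₁ S₂ x) ([]=⇒lookup x∈S₂))

∈─⇒∉ : ∀ {n} (p q : Subset n) {x} → x ∈ p ─ q → x ∉ q
∈─⇒∉ (s ∷ p) (outside ∷ q) here ()
∈─⇒∉ (s ∷ p) (t ∷ q) (there x∈p─q) (there x∈q) = ∈─⇒∉ p q x∈p─q x∈q

∈-remove⁻ : ∀ {n} {p : Subset n} {x y} → x ∈ p - y → x ∈ p × x ≢ y
∈-remove⁻ {p = p} {y = y} x∈p-y = p─q⊆p p ⁅ y ⁆ x∈p-y , x∉⁅y⁆⇒x≢y (∈─⇒∉ p ⁅ y ⁆ x∈p-y)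

∣p∣≤∣p─q∣+∣q∣ : ∀ {n} (p q : Subset n) → ∣ p ∣ ≤ ∣ p ─ q ∣ + ∣ q ∣
∣p∣≤∣p─q∣+∣q∣ [] [] = z≤n
∣p∣≤∣p─q∣+∣q∣ (inside ∷ p) (outside ∷ q) = s≤s (∣p∣≤∣p─q∣+∣q∣ p q)
∣p∣≤∣p─q∣+∣q∣ (outside ∷ p) (outside ∷ q) = ∣p∣≤∣p─q∣+∣q∣ p q
∣p∣≤∣p─q∣+∣q∣ (inside ∷ p) (inside ∷ q) =
  subst (suc ∣ p ∣ ≤_) (≡-sym (+-suc ∣ p ─ q ∣ ∣ q ∣)) (s≤s (∣p∣≤∣p─q∣+∣q∣ p q))
∣p∣≤∣p─q∣+∣q∣ (outside ∷ p) (inside ∷ q) =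
  ≤-trans (∣p∣≤∣p─q∣+∣q∣ p q) (+-monoʳ-≤ ∣ p ─ q ∣ (m≤n⇒m≤1+n ≤-refl))

remove-≥ : ∀ {n k} (p : Subset n) x → suc k ≤ ∣ p ∣ → k ≤ ∣ p - x ∣
remove-≥ p x k<∣p∣ = s≤s⁻¹ (≤-trans k<∣p∣ (subst (∣ p ∣ ≤_) ∣p-x∣+1 (∣p∣≤∣p─q∣+∣q∣ p ⁅ x ⁆)))
  where
    ∣p-x∣+1 : ∣ p - x ∣ + ∣ ⁅ x ⁆ ∣ ≡ suc ∣ p - x ∣
    ∣p-x∣+1 = trans (cong (∣ p - x ∣ +_) (∣⁅x⁆∣≡1 x)) (+-comm ∣ p - x ∣ 1)

full : ∀ {n} {p : Subset n} {x} → ∣ p ∣ ≡ n → x ∈ p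
full {x = x} ∣p∣≡n = subst (x ∈_) (≡-sym (∣p∣≡n⇒p≡⊤ ∣p∣≡n)) ∈⊤

not-full : ∀ {n} (p : Subset (suc n)) → ∣ p ∣ ≢ suc n → ∣ p ∣ ≤ n
not-full p ∣p∣≢1+n = s≤s⁻¹ (≤∧≢⇒< (∣p∣≤n p) ∣p∣≢1+n)

add-outside : ∀ {n} {p : Subset n} {x} → x ∉ p → suc ∣ p ∣ ≤ ∣ p ∪ ⁅ x ⁆ ∣
add-outside {p = p} {x} x∉p = p⊂q⇒∣p∣<∣q∣ (p⊆p∪q ⁅ x ⁆ , x , x∈p∪q⁺ (inj₂ (x∈⁅x⁆ x)) , x∉p)

two-outside : ∀ {n} {p : Subset n} {x y} → x ≢ y → x ∉ p → y ∉ p → 2 + ∣ p ∣ ≤ n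
two-outside {n} {p} {x} {y} x≢y x∉p y∉p =
  ≤-trans (s≤s (add-outside x∉p)) (≤-trans (add-outside y∉p∪x) (∣p∣≤n ((p ∪ ⁅ x ⁆) ∪ ⁅ y ⁆)))
  where
    y∉p∪x : y ∉ p ∪ ⁅ x ⁆
    y∉p∪x y∈ = [ y∉p , (λ y∈⁅x⁆ → x≢y (≡-sym (x∈⁅y⁆⇒x≡y x y∈⁅x⁆))) ]′ (x∈p∪q⁻ p ⁅ x ⁆ y∈)

misses-at-most-one : ∀ {n} {p : Subset n} {x y} → n ≤ suc ∣ p ∣ → x ≢ y → x ∈ p ⊎ y ∈ p
misses-at-most-one {p = p} {x} {y} big x≢y with x ∈? p | y ∈? p
... | yes x∈p | _ = inj₁ x∈p
... | no _ | yes y∈p = inj₂ y∈p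
... | no x∉p | no y∉p = ⊥-elim (<-irrefl refl (s≤s⁻¹ (≤-trans (two-outside x≢y x∉p y∉p) big)))

shrink : ∀ {n} (p : Subset n) k → k ≤ ∣ p ∣ → Σ (Subset n) λ q → q ⊆ p × ∣ q ∣ ≡ k
shrink {n} p 0 _ = ∅ , ⊥⊆ , ∣⊥∣≡0 n
shrink (inside ∷ p) (suc k) (s≤s k≤∣p∣) with shrink p k k≤∣p∣
... | q , q⊆p , ∣q∣≡k = inside ∷ q , s⊆s q⊆p , cong suc ∣q∣≡k
shrink (outside ∷ p) (suc k) k<∣p∣ with shrink p (suc k) k<∣p∣
... | q , q⊆p , ∣q∣≡k = outside ∷ q , out⊆ q⊆p , ∣q∣≡k

module _ {m n} {σ : Fin m → Fin n} {T : Subset m} {S : Subset n}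
         (σT⊆S : ∀ {z} → z ∈ T → σ z ∈ S) where

  avoid : ∀ w → (∀ {z} → σ z ≢ w) → ∀ {z} → z ∈ T → σ z ∈ S - w
  avoid _ σ≢w z∈T = x∈p∧x≢y⇒x∈p-y (σT⊆S z∈T) σ≢w

  remove-image : Injective _≡_ _≡_ σ → ∀ a {z} → z ∈ T - a → σ z ∈ S - σ a
  remove-image σ-inj _ z∈T-a with ∈-remove⁻ z∈T-a
  ... | z∈T , z≢a = x∈p∧x≢y⇒x∈p-y (σT⊆S z∈T) (z≢a ∘ σ-inj)

record Selection {n} {X Y : Set} (F : Fin n → X) (c : Y → X) (s : ℕ) : Set where
  constructor selection
  field
    index           : Fin s → Fin n
    index-injective : Injective _≡_ _≡_ index
    value           : Fin s → Y
    at-index        : ∀ i → F (index i) ≡ c (value i)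

module _ {X Y : Set} {c : Y → X} where

  select-none : ∀ {n} {F : Fin n → X} → Selection F c 0
  select-none = selection (λ ()) (λ { {()} }) (λ ()) (λ ())

  select-zero : ∀ {n s} {F : Fin (suc n) → X} {y} → F zero ≡ c y → Selection (F ∘ suc) c s →
    Selection F c (suc s)
  select-zero {y = y} F₀ (selection h h-inj g on-c) =
    selection (lift 1 h) (lift-injective h h-inj 1) (λ { zero → y ; (suc i) → g i })
              (λ { zero → F₀ ; (suc i) → on-c i })

  skip-zero : ∀ {n s} {F : Fin (suc n) → X} → Selection (F ∘ suc) c s → Selection F c s
  skip-zero (selection h h-inj g on-c) = selection (suc ∘ h) (h-inj ∘ Fin-suc-injective) g on-c

pigeonhole : ∀ {A B : Set} a b {n} → suc (a + b) ≤ n → (F : Fin n → A ⊎ B) →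
  Selection F inj₁ (suc a) ⊎ Selection F inj₂ (suc b)
pigeonhole a b {suc n} (s≤s a+b≤n) F with F zero in F₀
pigeonhole 0 b {suc n} _ F | inj₁ _ = inj₁ (select-zero F₀ select-none)
pigeonhole (suc a) b {suc n} (s≤s a+b≤n) F | inj₁ _ =
  Sum.map (select-zero F₀) skip-zero (pigeonhole a b a+b≤n (F ∘ suc))
pigeonhole a 0 {suc n} _ F | inj₂ _ = inj₂ (select-zero F₀ select-none)
pigeonhole a (suc b) {suc n} (s≤s a+b≤n) F | inj₂ _ =
  Sum.map skip-zero (select-zero F₀) (pigeonhole a b (subst (_≤ n) (+-suc a b) a+b≤n) (F ∘ suc))

FailsAtMostOnce : (Fin 3 → Set) → Set
FailsAtMostOnce P = ∀ x y → x ≢ y → P x ⊎ P y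

holds-off-zero : ∀ {R} → FailsAtMostOnce R → ¬ R zero → ∀ {k} → zero ≢ k → R k
holds-off-zero R-once ¬R₀ 0≢k = [ ⊥-elim ∘ ¬R₀ , id ]′ (R-once zero _ 0≢k)

common-off-zero : ∀ {P Q} → FailsAtMostOnce P → FailsAtMostOnce Q → ¬ P zero →
  ∃ λ k → P k × Q k
common-off-zero P-once Q-once ¬P₀ =
  [ (λ Q₁ → one , holds-off-zero P-once ¬P₀ (λ ()) , Q₁) ,
    (λ Q₂ → two , holds-off-zero P-once ¬P₀ (λ ()) , Q₂) ]′ (Q-once one two (λ ()))
  where
    one two : Fin 3
    one = suc zero
    two = suc (suc zero)

common-index : ∀ {P Q} → Dec (P zero) → Dec (Q zero) →
  FailsAtMostOnce P → FailsAtMostOnce Q → ∃ λ k → P k × Q k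
common-index (yes P₀) (yes Q₀) _ _ = zero , P₀ , Q₀
common-index (no ¬P₀) _ P-once Q-once = common-off-zero P-once Q-once ¬P₀
common-index (yes _) (no ¬Q₀) P-once Q-once = map₂ swap (common-off-zero Q-once P-once ¬Q₀)

IsClique : ∀ {k n} → KPartiteGraph k n → {I : Set} → (I → Fin n) → Set
IsClique G f = ∀ i j → i ≢ j → Adj G (f i) (f j)

Covers : ∀ {k n} → KPartiteGraph k n → ℕ → Set
Covers {k} G s = ∀ (U : Subset k) → ∣ U ∣ ≡ s → CliqueIn G s U

clique-mono : ∀ {k n s} {G : KPartiteGraph k n} {T S : Subset k} → T ⊆ S →
  CliqueIn G s T → CliqueIn G s S
clique-mono T⊆S (f , f-clique , f-in) = f , f-clique , T⊆S ∘ f-in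

cover-≥ : ∀ {k n s} {G : KPartiteGraph k n} → Covers G s → ∀ T → s ≤ ∣ T ∣ → CliqueIn G s T
cover-≥ {s = s} {G} cov T s≤∣T∣ with shrink T s s≤∣T∣
... | U , U⊆T , ∣U∣≡s = clique-mono {G = G} U⊆T (cov U ∣U∣≡s)

edge-clique : ∀ {k n} (G : KPartiteGraph k n) {S u v} → Adj G u v → part G u ∈ S → part G v ∈ S →
  CliqueIn G 2 S
edge-clique {n = n} G {S} {u} {v} uv u∈S v∈S = ends , adjacent , in-S
  where
    ends : Fin 2 → Fin n
    ends zero = u
    ends (suc _) = v
    adjacent : IsClique G ends
    adjacent zero zero 0≢0 = ⊥-elim (0≢0 refl)
    adjacent zero (suc zero) _ = uv
    adjacent (suc zero) zero _ = sym G uv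
    adjacent (suc zero) (suc zero) 1≢1 = ⊥-elim (1≢1 refl)
    in-S : ∀ i → part G (ends i) ∈ S
    in-S zero = u∈S
    in-S (suc _) = v∈S

relabel : ∀ {k k′ n} (ρ : Fin k → Fin k′) → Injective _≡_ _≡_ ρ → KPartiteGraph k n →
  KPartiteGraph k′ n
relabel ρ ρ-inj G = record
  { part = ρ ∘ part G ; Adj = Adj G ; sym = sym G ; partite = λ uv → partite G uv ∘ ρ-inj }

module _ {k k′ n} (ρ : Fin k → Fin k′) (ρ-inj : Injective _≡_ _≡_ ρ) (G : KPartiteGraph k n) where

  relabel-free : ∀ {s} → KFree G s → KFree (relabel ρ ρ-inj G) s
  relabel-free free _ (f , f-clique , _) = free ⊤ (f , f-clique , λ _ → ∈⊤)

  relabel-clique : ∀ {s T S} → (∀ {x} → x ∈ T → ρ x ∈ S) → CliqueIn G s T →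
    CliqueIn (relabel ρ ρ-inj G) s S
  relabel-clique ρT⊆S (f , f-clique , f-in) = f , f-clique , ρT⊆S ∘ f-in

module Join {k n₁ n₂} (G₁ : KPartiteGraph k n₁) (G₂ : KPartiteGraph k n₂) where

  part⊎ : Fin n₁ ⊎ Fin n₂ → Fin k
  part⊎ = [ part G₁ , part G₂ ]′

  Adj⊎ : Fin n₁ ⊎ Fin n₂ → Fin n₁ ⊎ Fin n₂ → Set
  Adj⊎ (inj₁ x) (inj₁ y) = Adj G₁ x y
  Adj⊎ (inj₂ x) (inj₂ y) = Adj G₂ x y
  Adj⊎ u v = part⊎ u ≢ part⊎ v

  sym⊎ : ∀ u v → Adj⊎ u v → Adj⊎ v u
  sym⊎ (inj₁ x) (inj₁ y) = sym G₁
  sym⊎ (inj₂ x) (inj₂ y) = sym G₂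
  sym⊎ (inj₁ x) (inj₂ y) apart = apart ∘ ≡-sym
  sym⊎ (inj₂ x) (inj₁ y) apart = apart ∘ ≡-sym

  partite⊎ : ∀ u v → Adj⊎ u v → part⊎ u ≢ part⊎ v
  partite⊎ (inj₁ x) (inj₁ y) = partite G₁
  partite⊎ (inj₂ x) (inj₂ y) = partite G₂
  partite⊎ (inj₁ x) (inj₂ y) apart = apart
  partite⊎ (inj₂ x) (inj₁ y) apart = apart

  join : KPartiteGraph k (n₁ + n₂)
  join = record
    { part = part⊎ ∘ splitAt n₁
    ; Adj = λ u v → Adj⊎ (splitAt n₁ u) (splitAt n₁ v)
    ; sym = λ {u} {v} → sym⊎ (splitAt n₁ u) (splitAt n₁ v)
    ; partite = λ {u} {v} → partite⊎ (splitAt n₁ u) (splitAt n₁ v)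
    }

  vertex : Fin n₁ ⊎ Fin n₂ → Fin (n₁ + n₂)
  vertex = Fin.join n₁ n₂

  vertex-adj : ∀ {u v} → Adj⊎ u v → Adj join (vertex u) (vertex v)
  vertex-adj {u} {v} = subst₂ Adj⊎ (≡-sym (splitAt-join n₁ n₂ u)) (≡-sym (splitAt-join n₁ n₂ v))

  vertex-part : ∀ u → part join (vertex u) ≡ part⊎ u
  vertex-part u = cong part⊎ (splitAt-join n₁ n₂ u)

  selected-clique : ∀ {s t} {Y : Set} {c : Y → Fin n₁ ⊎ Fin n₂} {f : Fin s → Fin (n₁ + n₂)} →
    IsClique join f → (sel : Selection (splitAt n₁ ∘ f) c t) →
    ∀ i j → i ≢ j → Adj⊎ (c (Selection.value sel i)) (c (Selection.value sel j))
  selected-clique f-clique (selection h h-inj g on-c) i j i≢j =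
    subst₂ Adj⊎ (on-c i) (on-c j) (f-clique (h i) (h j) (i≢j ∘ h-inj))

  join-free : ∀ {a b} → KFree G₁ (suc a) → KFree G₂ (suc b) → KFree join (suc (a + b))
  join-free {a} {b} free₁ free₂ _ (f , f-clique , _) with pigeonhole a b ≤-refl (splitAt n₁ ∘ f)
  ... | inj₁ sel = free₁ ⊤ (Selection.value sel , selected-clique f-clique sel , λ _ → ∈⊤)
  ... | inj₂ sel = free₂ ⊤ (Selection.value sel , selected-clique f-clique sel , λ _ → ∈⊤)

  join-clique : ∀ {a b S} (K₁ : CliqueIn G₁ a S) (K₂ : CliqueIn G₂ b S) →
    (∀ i j → part G₁ (proj₁ K₁ i) ≢ part G₂ (proj₁ K₂ j)) → CliqueIn join (a + b) S
  join-clique {a} {b} {S} (f , f-clique , f-in) (g , g-clique , g-in) apart =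
    vertex ∘ w ∘ splitAt a , clique ,
    λ i → subst (_∈ S) (≡-sym (vertex-part (w (splitAt a i)))) (w-in (splitAt a i))
    where
      w : Fin a ⊎ Fin b → Fin n₁ ⊎ Fin n₂
      w = Sum.map f g
      w-clique : ∀ i j → i ≢ j → Adj⊎ (w i) (w j)
      w-clique (inj₁ i) (inj₁ j) i≢j = f-clique i j (i≢j ∘ cong inj₁)
      w-clique (inj₂ i) (inj₂ j) i≢j = g-clique i j (i≢j ∘ cong inj₂)
      w-clique (inj₁ i) (inj₂ j) _ = apart i j
      w-clique (inj₂ i) (inj₁ j) _ = apart j i ∘ ≡-sym
      w-in : ∀ u → part⊎ (w u) ∈ S
      w-in (inj₁ i) = f-in i
      w-in (inj₂ j) = g-in j
      clique : IsClique join (vertex ∘ w ∘ splitAt a)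
      clique i j i≢j = vertex-adj {w (splitAt a i)} {w (splitAt a j)}
                                  (w-clique _ _ (i≢j ∘ splitAt-injective a))

  join-edge : ∀ {s S u v} → CliqueIn G₁ s (S - part G₂ u - part G₂ v) → Adj G₂ u v →
    part G₂ u ∈ S → part G₂ v ∈ S → CliqueIn join (s + 2) S
  join-edge {S = S} {u} {v} K uv u∈S v∈S =
    join-clique (clique-mono {G = G₁} (proj₁ ∘ in-S) K) (edge-clique G₂ uv u∈S v∈S) apart
    where
      in-S : ∀ {x} → x ∈ S - part G₂ u - part G₂ v → x ∈ S × x ≢ part G₂ u
      in-S = ∈-remove⁻ ∘ proj₁ ∘ ∈-remove⁻
      apart : ∀ i j → part G₁ (proj₁ K i) ≢ part G₂ (proj₁ (edge-clique G₂ uv u∈S v∈S) j)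
      apart i zero = proj₂ (in-S (proj₂ (proj₂ K) i))
      apart i (suc zero) = proj₂ (∈-remove⁻ (proj₂ (proj₂ K) i))

open Join using (join; join-free; join-clique; join-edge)

-- The gadget H: vertices aₖ = k and bₖ = 3 + k for k < 3, each in its own part; its edges
-- are the 4-cycle a₀ a₁ b₁ b₀ and the edge a₂ b₂, so every aₖ bₖ is an edge.

gadgetEdge : ℕ → ℕ → Bool
gadgetEdge 0 1 = true
gadgetEdge 0 3 = true
gadgetEdge 1 4 = true
gadgetEdge 2 5 = true
gadgetEdge 3 4 = true
gadgetEdge _ _ = false

GadgetAdj : Fin 6 → Fin 6 → Set
GadgetAdj x y = T (gadgetEdge (toℕ x) (toℕ y) ∨ gadgetEdge (toℕ y) (toℕ x))

gadgetAdj? : ∀ x y → Dec (GadgetAdj x y)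
gadgetAdj? x y = T? (gadgetEdge (toℕ x) (toℕ y) ∨ gadgetEdge (toℕ y) (toℕ x))

-- The following two facts are finite checks, decided by evaluation.
gadget-loopless : ∀ x → ¬ GadgetAdj x x
gadget-loopless = toWitness {a? = all? λ x → ¬? (gadgetAdj? x x)} _

gadget-triangle-free : ∀ x y z → ¬ (GadgetAdj x y × GadgetAdj y z × GadgetAdj x z)
gadget-triangle-free = toWitness {a? = all? λ x → all? λ y → all? λ z →
  ¬? (gadgetAdj? x y ×-dec gadgetAdj? y z ×-dec gadgetAdj? x z)} _

gadget-a gadget-b : Fin 3 → Fin 6
gadget-a k = k ↑ˡ 3
gadget-b k = 3 ↑ʳ k

gadget-a₀a₁ : GadgetAdj (gadget-a zero) (gadget-a (suc zero))
gadget-a₀a₁ = _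

gadget-b₀b₁ : GadgetAdj (gadget-b zero) (gadget-b (suc zero))
gadget-b₀b₁ = _

gadget-matching : ∀ k → GadgetAdj (gadget-a k) (gadget-b k)
gadget-matching zero = _
gadget-matching (suc zero) = _
gadget-matching (suc (suc zero)) = _

Gadget : KPartiteGraph 6 6
Gadget = record
  { part = id
  ; Adj = GadgetAdj
  ; sym = λ {x} {y} → subst T (∨-comm (gadgetEdge (toℕ x) (toℕ y)) (gadgetEdge (toℕ y) (toℕ x)))
  ; partite = λ {x} xy x≡y → gadget-loopless x (subst (GadgetAdj x) (≡-sym x≡y) xy)
  }

gadget-free : KFree Gadget 3
gadget-free _ (f , f-clique , _) = gadget-triangle-free (f zero) (f one) (f two)
  (f-clique zero one (λ ()) , f-clique one two (λ ()) , f-clique zero two (λ ()))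
  where
    one two : Fin 3
    one = suc zero
    two = suc (suc zero)

-- Clique sizes: (r₁ - 2) + (r₂ - 2) + 2 = r₁ + r₂ - 2 for r₁ = 3 + p and r₂ = 3 + q.
size-cover : ∀ p q → suc p + suc q + 2 ≡ suc (p + (3 + q))
size-cover = solve-∀

-- Rewriting ∣ S₁ ∣ + ∣ S₂ ∣ = r₁ + r₂ - 2 to compare with r₁ - 1 + r₂ - 1 and r₁ + (r₂ - 2).
size-slices : ∀ p q → suc (p + (3 + q)) ≡ 2 + p + (2 + q)
size-slices = solve-∀

size-one-full : ∀ p q → 3 + p + suc q ≡ 2 + p + (2 + q)
size-one-full = solve-∀

module Construction (p q : ℕ) {n₁ n₂}
  (G₁ : KPartiteGraph (3 + p) n₁) (G₂ : KPartiteGraph (3 + q) n₂) where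

  r₁ r₂ : ℕ
  r₁ = 3 + p
  r₂ = 3 + q

  inl : Fin r₁ → Fin (r₁ + r₂)
  inl = _↑ˡ r₂

  inr : Fin r₂ → Fin (r₁ + r₂)
  inr = r₁ ↑ʳ_

  inl-injective : Injective _≡_ _≡_ inl
  inl-injective = ↑ˡ-injective r₂ _ _

  inr-injective : Injective _≡_ _≡_ inr
  inr-injective = ↑ʳ-injective r₁ _ _

  inl≢inr : ∀ {x y} → inl x ≢ inr y
  inl≢inr = ↑ˡ≢↑ʳ _ _

  inr≢inl : ∀ {x y} → inr y ≢ inl x
  inr≢inl = inl≢inr ∘ ≡-sym

  -- aₖ lies in the k-th part of G₁ and bₖ in the k-th part of G₂.
  gadget-part : Fin 6 → Fin (r₁ + r₂)
  gadget-part = [ inl ∘ (_↑ˡ p) , inr ∘ (_↑ˡ q) ]′ ∘ splitAt 3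

  gadget-part-injective : Injective _≡_ _≡_ gadget-part
  gadget-part-injective =
    glue-injective (↑ˡ-injective p _ _ ∘ inl-injective) (↑ˡ-injective q _ _ ∘ inr-injective)
                   (λ _ _ → inl≢inr)

  gadget-part-a : ∀ k → gadget-part (gadget-a k) ≡ inl (k ↑ˡ p)
  gadget-part-a k = cong [ inl ∘ (_↑ˡ p) , inr ∘ (_↑ˡ q) ]′ (splitAt-↑ˡ 3 k 3)

  gadget-part-b : ∀ k → gadget-part (gadget-b k) ≡ inr (k ↑ˡ q)
  gadget-part-b k = cong [ inl ∘ (_↑ˡ p) , inr ∘ (_↑ˡ q) ]′ (splitAt-↑ʳ 3 3 k)

  G₁′ : KPartiteGraph (r₁ + r₂) n₁
  G₁′ = relabel inl inl-injective G₁

  G₂′ : KPartiteGraph (r₁ + r₂) n₂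
  G₂′ = relabel inr inr-injective G₂

  H : KPartiteGraph (r₁ + r₂) 6
  H = relabel gadget-part gadget-part-injective Gadget

  G : KPartiteGraph (r₁ + r₂) (n₁ + n₂ + 6)
  G = join (join G₁′ G₂′) H

  G-free : KFree G₁ (2 + p) → KFree G₂ (2 + q) → KFree G (r₁ + r₂ ∸ 1)
  G-free free₁ free₂ = subst (KFree G) (cong suc (size-cover p q))
    (join-free (join G₁′ G₂′) H
      (join-free G₁′ G₂′ (relabel-free inl inl-injective G₁ free₁)
                         (relabel-free inr inr-injective G₂ free₂))
      (relabel-free gadget-part gadget-part-injective Gadget gadget-free))

  module Covering (cover₁ : Covers G₁ (suc p)) (cover₂ : Covers G₂ (suc q)) where

    clique-around-edge : ∀ {S x y} (e₁ e₂ : Fin 6) → GadgetAdj e₁ e₂ →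
      gadget-part e₁ ≡ x → gadget-part e₂ ≡ y → x ∈ S → y ∈ S →
      (T₁ : Subset r₁) → suc p ≤ ∣ T₁ ∣ → (∀ {z} → z ∈ T₁ → inl z ∈ S - x - y) →
      (T₂ : Subset r₂) → suc q ≤ ∣ T₂ ∣ → (∀ {z} → z ∈ T₂ → inr z ∈ S - x - y) →
      CliqueIn G (suc p + suc q + 2) S
    clique-around-edge e₁ e₂ e₁e₂ refl refl x∈S y∈S T₁ large₁ T₁⊆ T₂ large₂ T₂⊆ =
      join-edge (join G₁′ G₂′) H {u = e₁} {v = e₂}
        (join-clique G₁′ G₂′
          (relabel-clique inl inl-injective G₁ T₁⊆ (cover-≥ {G = G₁} cover₁ T₁ large₁))
          (relabel-clique inr inr-injective G₂ T₂⊆ (cover-≥ {G = G₂} cover₂ T₂ large₂))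
          (λ _ _ → inl≢inr))
        e₁e₂ x∈S y∈S

    left-full : ∀ S₁ S₂ → ∣ S₁ ∣ ≡ r₁ → suc q ≤ ∣ S₂ ∣ → CliqueIn G (suc p + suc q + 2) (S₁ ++ S₂)
    left-full S₁ S₂ ∣S₁∣≡r₁ large₂ =
      clique-around-edge (gadget-a zero) (gadget-a (suc zero)) gadget-a₀a₁ refl refl in-S in-S
        T₁ large₁
        (remove-image (remove-image (∈-++⁺ˡ S₂) inl-injective zero) inl-injective (suc zero))
        S₂ large₂ (avoid (avoid (∈-++⁺ʳ S₁) (inl zero) inr≢inl) (inl (suc zero)) inr≢inl)
      where
        in-S : ∀ {x} → inl x ∈ S₁ ++ S₂
        in-S = ∈-++⁺ˡ S₂ (full ∣S₁∣≡r₁)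
        T₁ : Subset r₁
        T₁ = S₁ - zero - suc zero
        large₁ : suc p ≤ ∣ T₁ ∣
        large₁ = remove-≥ (S₁ - zero) (suc zero) (remove-≥ S₁ zero (≤-reflexive (≡-sym ∣S₁∣≡r₁)))

    right-full : ∀ S₁ S₂ → ∣ S₂ ∣ ≡ r₂ → suc p ≤ ∣ S₁ ∣ → CliqueIn G (suc p + suc q + 2) (S₁ ++ S₂)
    right-full S₁ S₂ ∣S₂∣≡r₂ large₁ =
      clique-around-edge (gadget-b zero) (gadget-b (suc zero)) gadget-b₀b₁ refl refl in-S in-S
        S₁ large₁ (avoid (avoid (∈-++⁺ˡ S₂) (inr zero) inl≢inr) (inr (suc zero)) inl≢inr)
        T₂ large₂
        (remove-image (remove-image (∈-++⁺ʳ S₁) inr-injective zero) inr-injective (suc zero))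
      where
        in-S : ∀ {x} → inr x ∈ S₁ ++ S₂
        in-S = ∈-++⁺ʳ S₁ (full ∣S₂∣≡r₂)
        T₂ : Subset r₂
        T₂ = S₂ - zero - suc zero
        large₂ : suc q ≤ ∣ T₂ ∣
        large₂ = remove-≥ (S₂ - zero) (suc zero) (remove-≥ S₂ zero (≤-reflexive (≡-sym ∣S₂∣≡r₂)))

    -- When each side misses one part, some aₖ and bₖ both lie in S; use the edge aₖ bₖ.
    both-miss-one : ∀ S₁ S₂ → 2 + p ≤ ∣ S₁ ∣ → 2 + q ≤ ∣ S₂ ∣ →
      CliqueIn G (suc p + suc q + 2) (S₁ ++ S₂)
    both-miss-one S₁ S₂ large₁ large₂
      with common-index {λ k → k ↑ˡ p ∈ S₁} {λ k → k ↑ˡ q ∈ S₂} (zero ∈? S₁) (zero ∈? S₂)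
             (λ x y x≢y → misses-at-most-one (s≤s large₁) (x≢y ∘ ↑ˡ-injective p x y))
             (λ x y x≢y → misses-at-most-one (s≤s large₂) (x≢y ∘ ↑ˡ-injective q x y))
    ... | k , aₖ∈S₁ , bₖ∈S₂ =
      clique-around-edge (gadget-a k) (gadget-b k) (gadget-matching k)
        (gadget-part-a k) (gadget-part-b k)
        (∈-++⁺ˡ S₂ aₖ∈S₁) (∈-++⁺ʳ S₁ bₖ∈S₂)
        (S₁ - (k ↑ˡ p)) (remove-≥ S₁ _ large₁)
        (avoid (remove-image (∈-++⁺ˡ S₂) inl-injective (k ↑ˡ p)) (inr (k ↑ˡ q)) inl≢inr)
        (S₂ - (k ↑ˡ q)) (remove-≥ S₂ _ large₂)
        (remove-image (avoid (∈-++⁺ʳ S₁) (inl (k ↑ˡ p)) inr≢inl) inr-injective (k ↑ˡ q))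

    cover-slices : ∀ S₁ S₂ → ∣ S₁ ∣ + ∣ S₂ ∣ ≡ suc (p + (3 + q)) →
      CliqueIn G (suc p + suc q + 2) (S₁ ++ S₂)
    cover-slices S₁ S₂ total = by-cases (∣ S₁ ∣ ≟ r₁) (∣ S₂ ∣ ≟ r₂)
      where
        total₁₂ : ∣ S₁ ∣ + ∣ S₂ ∣ ≡ 2 + p + (2 + q)
        total₁₂ = trans total (size-slices p q)
        total₂₁ : ∣ S₂ ∣ + ∣ S₁ ∣ ≡ 2 + q + (2 + p)
        total₂₁ = trans (+-comm ∣ S₂ ∣ ∣ S₁ ∣) (trans total₁₂ (+-comm (2 + p) (2 + q)))
        by-cases : Dec (∣ S₁ ∣ ≡ r₁) → Dec (∣ S₂ ∣ ≡ r₂) → CliqueIn G (suc p + suc q + 2) (S₁ ++ S₂)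
        by-cases (yes ∣S₁∣≡r₁) _ = left-full S₁ S₂ ∣S₁∣≡r₁
          (slack (trans total₁₂ (≡-sym (size-one-full p q))) (∣p∣≤n S₁))
        by-cases (no _) (yes ∣S₂∣≡r₂) = right-full S₁ S₂ ∣S₂∣≡r₂
          (slack (trans total₂₁ (≡-sym (size-one-full q p))) (∣p∣≤n S₂))
        by-cases (no ∣S₁∣≢r₁) (no ∣S₂∣≢r₂) = both-miss-one S₁ S₂
          (slack total₂₁ (not-full S₂ ∣S₂∣≢r₂)) (slack total₁₂ (not-full S₁ ∣S₁∣≢r₁))

    G-cover : ∀ S → ∣ S ∣ ≡ r₁ + r₂ ∸ 2 → CliqueIn G (r₁ + r₂ ∸ 1 ∸ 1) S
    G-cover S ∣S∣ with Vec.splitAt r₁ S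
    ... | S₁ , S₂ , refl =
      subst (λ s → CliqueIn G s (S₁ ++ S₂)) (size-cover p q)
            (cover-slices S₁ S₂ (trans (≡-sym (∣++∣ S₁ S₂)) ∣S∣))

lemma6p2 : ∀ (r₁ r₂ : ℕ) → 3 ≤ r₁ → 3 ≤ r₂ →
    ∀ (b₁ b₂ b : ℕ) → IsBeta₂ r₁ b₁ → IsBeta₂ r₂ b₂ → IsBeta₂ (r₁ + r₂) b →
    b ≤ b₁ + b₂ + 6
lemma6p2 (suc (suc (suc p))) (suc (suc (suc q))) (s≤s (s≤s (s≤s _))) (s≤s (s≤s (s≤s _)))
  b₁ b₂ b ((G₁ , free₁ , cover₁) , _) ((G₂ , free₂ , cover₂) , _) (_ , minimal) =
  minimal (b₁ + b₂ + 6) (G , G-free free₁ free₂ , Covering.G-cover cover₁ cover₂)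
  where open Construction p q G₁ G₂
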